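{- Let $M$ be a simply typed $\mu$-closed simple $\lambda\mu$-term. Then there exists a canonical normal form which is $\beta\eta\mu\rho\theta$-equivalent to $M$. More precisely, $M$ can be turned into a canonical normal form using only $\beta$-, $\mu$-, $\rho$- and $\nu$-reductions and $\eta$- and $\theta$-expansions.
   Context: Simple types are built from atomic types (propositional atoms $X,Y,\dots$, among which a distinguished atom $\bot$) with $\rightarrow$; every type has the form $A_1\rightarrow\cdots\rightarrow A_n\rightarrow X$ with $X$ atomic. $\lambda\mu$-terms use disjoint sets of $\lambda$-variables $a,b,\dots$ and $\mu$-variables $\alpha,\beta,\dots$ and are generated by $M::=a\mid\lambda a.M\mid(M)M\mid[\alpha]M\mid\mu\alpha.M$ (up to $\alpha$-equivalence), typed by judgments $\Gamma\vdash M:A\mid\Delta$ with rules: $\Gamma,a:A\vdash a:A\mid\Delta$; from $\Gamma,a:A\vdash M:B\mid\Delta$ infer $\Gamma\vdash\lambda a.M:A\rightarrow B\mid\Delta$; from $M:A\rightarrow B$, $N:A$ infer $(M)N:B$; from $\Gamma\vdash M:A\mid\Delta,\alpha:A$ infer $\Gamma\vdash[\alpha]M:\bot\mid\Delta,\alpha:A$; from $\Gamma\vdash M:\bot\mid\Delta,\alpha:A$ infer $\Gamma\vdash\mu\alpha.M:A\mid\Delta$. A simple $\lambda\mu$-term is one generated by $M::=a\mid\lambda a.M\mid(M)M\mid\mu\alpha[\beta]M$, where $\mu\alpha[\beta]M$ abbreviates $\mu\alpha.[\beta]M$. A term is $\mu$-closed if it has no free $\mu$-variables (free $\lambda$-variables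 are allowed). Rewriting rules (applicable to any subterm, on typed terms): $\beta$: $(\lambda a.M)N\to M[N/a]$; $\eta$: $\lambda a.(M)a\to M$ ($a\notin M$); $\mu$: $(\mu\alpha.M)N\to\mu\alpha.M[[\alpha](L)N/[\alpha]L]$; $\rho$: $[\beta]\mu\alpha.M\to M[\beta/\alpha]$; $\theta$: $\mu\alpha[\alpha]M\to M$ ($\alpha\notin M$); $\nu$: $\mu\alpha.M\to\lambda a.\mu\alpha.M[[\alpha](L)a/[\alpha]L]$ ($a\notin M$, and $\mu\alpha.M$ of arrow type). Here $M[\mathcal{C}[L]/[\alpha]L]$ replaces every subterm $[\alpha]L$ of $M$ by $\mathcal{C}[L]$. An $\eta$- (resp. $\theta$-) expansion is the reverse of an $\eta$- (resp. $\theta$-) step. $\beta\eta\mu\rho\theta$-equivalence is the congruence generated by $\beta,\eta,\mu,\rho,\theta$ as equations, together with $[\alpha]M=M$ when $M:\bot$. A simply typed simple term $M$ of type $A_1\rightarrow\cdots\rightarrow A_n\rightarrow X$ ($X$ atomic) is in canonical normal form if $M=\lambda a_1\dots\lambda a_n.\mu\alpha[\beta](b)M_1\dots M_k$ with $a_i$ of type $A_i$, $\alpha$ of type $X$, $\beta$ of type $Y$, $b$ a $\lambda$-variable of type $B_1\rightarrow\cdots\rightarrow B_k\rightarrow Y$ ($Y$ atomic), and each $M_j$ a canonical normal form of type $B_j$. -}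

module Defs where

open import Data.Nat using (ℕ)
open import Data.List using (List; []; _∷_)
open import Data.Product using (Σ; _×_; _,_)
open import Relation.Binary.Construct.Closure.ReflexiveTransitive using (Star)
open import Relation.Binary.Construct.Closure.Equivalence using (EqClosure)

data Atom : Set where
  ⊥ₐ   : Atom
  atom : ℕ → Atom

infixr 7 _⇒_
data Ty : Set where
  at  : Atom → Ty
  _⇒_ : Ty → Ty → Ty

⊥ₜ : Ty
⊥ₜ = at ⊥ₐ

Ctx : Set
Ctx = List Ty

infix 4 _∋_
data _∋_ : Ctx → Ty → Set where
  here  : ∀ {Γ A} → (A ∷ Γ) ∋ A
  there : ∀ {Γ A B} → Γ ∋ A → (B ∷ Γ) ∋ A

variable
  Γ Γ' Δ Δ' : Ctx
  A B C : Ty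

-- Intrinsically typed λμ-terms:  Tm Γ Δ A  is the set of terms M with
-- Γ ⊢ M : A ∣ Δ  (Γ: λ-variables, Δ: μ-variables), up to α-equivalence.

data Tm (Γ Δ : Ctx) : Ty → Set where
  var : Γ ∋ A → Tm Γ Δ A
  lam : Tm (A ∷ Γ) Δ B → Tm Γ Δ (A ⇒ B)
  app : Tm Γ Δ (A ⇒ B) → Tm Γ Δ A → Tm Γ Δ B
  nm  : Δ ∋ A → Tm Γ Δ A → Tm Γ Δ ⊥ₜ
  mu  : Tm Γ (A ∷ Δ) ⊥ₜ → Tm Γ Δ A

Ren : Ctx → Ctx → Set
Ren Γ Γ' = ∀ {A} → Γ ∋ A → Γ' ∋ A

ext : Ren Γ Γ' → Ren (B ∷ Γ) (B ∷ Γ')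
ext r here      = here
ext r (there x) = there (r x)

ren : Ren Γ Γ' → Ren Δ Δ' → Tm Γ Δ A → Tm Γ' Δ' A
ren r s (var x)   = var (r x)
ren r s (lam M)   = lam (ren (ext r) s M)
ren r s (app M N) = app (ren r s M) (ren r s N)
ren r s (nm α M)  = nm (s α) (ren r s M)
ren r s (mu M)    = mu (ren r (ext s) M)

idR : Ren Γ Γ
idR x = x

wkλ : Tm Γ Δ A → Tm (B ∷ Γ) Δ A
wkλ = ren there idR

wkμ : Tm Γ Δ A → Tm Γ (B ∷ Δ) A
wkμ = ren idR there

Sub : Ctx → Ctx → Ctx → Set
Sub Γ Γ' Δ = ∀ {A} → Γ ∋ A → Tm Γ' Δ A

exts : Sub Γ Γ' Δ → Sub (B ∷ Γ) (B ∷ Γ') Δ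
exts σ here      = var here
exts σ (there x) = wkλ (σ x)

extsμ : Sub Γ Γ' Δ → Sub Γ Γ' (B ∷ Δ)
extsμ σ x = wkμ (σ x)

sub : Sub Γ Γ' Δ → Tm Γ Δ A → Tm Γ' Δ A
sub σ (var x)   = σ x
sub σ (lam M)   = lam (sub (exts σ) M)
sub σ (app M N) = app (sub σ M) (sub σ N)
sub σ (nm α M)  = nm α (sub σ M)
sub σ (mu M)    = mu (sub (extsμ σ) M)

sub0 : Tm Γ Δ B → Sub (B ∷ Γ) Γ Δ
sub0 N here      = N
sub0 N (there x) = var x

_[_/0] : Tm (B ∷ Γ) Δ A → Tm Γ Δ B → Tm Γ Δ A
M [ N /0] = sub (sub0 N) M

ren0 : Δ ∋ A → Ren (A ∷ Δ) Δ
ren0 β here      = β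
ren0 β (there x) = x

_[_/α0] : Tm Γ (A ∷ Δ) C → Δ ∋ A → Tm Γ Δ C
M [ β /α0] = ren idR (ren0 β) M

-- Structural substitution  M[[α](L)N/[α]L].
-- An action tells, for each μ-variable, whether [α]L is kept as [α']L
-- (a renaming) or replaced by [α'](L)N.

data Act (Γ Δ : Ctx) : Ty → Set where
  keep : Δ ∋ C → Act Γ Δ C
  push : Δ ∋ B → Tm Γ Δ A → Act Γ Δ (A ⇒ B)

actλ : Act Γ Δ C → Act (B ∷ Γ) Δ C
actλ (keep x)   = keep x
actλ (push x N) = push x (wkλ N)

actμ : Act Γ Δ C → Act Γ (B ∷ Δ) C
actμ (keep x)   = keep (there x)
actμ (push x N) = push (there x) (wkμ N)

applyAct : Act Γ Δ C → Tm Γ Δ C → Tm Γ Δ ⊥ₜ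
applyAct (keep β)   L = nm β L
applyAct (push β N) L = nm β (app L N)

SSub : Ctx → Ctx → Ctx → Set
SSub Γ Δ Δ' = ∀ {C} → Δ ∋ C → Act Γ Δ' C

ssλ : SSub Γ Δ Δ' → SSub (B ∷ Γ) Δ Δ'
ssλ σ x = actλ (σ x)

ssμ : SSub Γ Δ Δ' → SSub Γ (B ∷ Δ) (B ∷ Δ')
ssμ σ here      = keep here
ssμ σ (there x) = actμ (σ x)

ssub : SSub Γ Δ Δ' → Tm Γ Δ A → Tm Γ Δ' A
ssub σ (var x)   = var x
ssub σ (lam M)   = lam (ssub (ssλ σ) M)
ssub σ (app M N) = app (ssub σ M) (ssub σ N)
ssub σ (nm α M)  = applyAct (σ α) (ssub σ M)
ssub σ (mu M)    = mu (ssub (ssμ σ) M)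

σapp : Tm Γ Δ A → SSub Γ ((A ⇒ B) ∷ Δ) (B ∷ Δ)
σapp N here      = push here (wkμ N)
σapp N (there x) = keep (there x)

data _→β_ : Tm Γ Δ A → Tm Γ Δ A → Set where
  β : {M : Tm (A ∷ Γ) Δ B} {N : Tm Γ Δ A} → app (lam M) N →β (M [ N /0])

-- λa.(M)a → M with a ∉ M (M is a weakening)
data _→η_ : Tm Γ Δ A → Tm Γ Δ A → Set where
  η : {M : Tm Γ Δ (A ⇒ B)} → lam (app (wkλ M) (var here)) →η M

data _→μ_ : Tm Γ Δ A → Tm Γ Δ A → Set where
  μ : {M : Tm Γ ((A ⇒ B) ∷ Δ) ⊥ₜ} {N : Tm Γ Δ A} →
      app (mu M) N →μ mu (ssub (σapp N) M)

data _→ρ_ : Tm Γ Δ A → Tm Γ Δ A → Set where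
  ρ : {β : Δ ∋ A} {M : Tm Γ (A ∷ Δ) ⊥ₜ} → nm β (mu M) →ρ (M [ β /α0])

data _→θ_ : Tm Γ Δ A → Tm Γ Δ A → Set where
  θ : {M : Tm Γ Δ A} → mu (nm here (wkμ M)) →θ M

data _→ν_ : Tm Γ Δ A → Tm Γ Δ A → Set where
  ν : {M : Tm Γ ((A ⇒ B) ∷ Δ) ⊥ₜ} →
      mu M →ν lam (mu (ssub (σapp (var here)) (wkλ M)))

data _=⊥_ : Tm Γ Δ A → Tm Γ Δ A → Set where
  bot : {α : Δ ∋ ⊥ₜ} {M : Tm Γ Δ ⊥ₜ} → nm α M =⊥ M

TmRel : Set₁
TmRel = ∀ {Γ Δ A} → Tm Γ Δ A → Tm Γ Δ A → Set

data Comp (R : TmRel) : TmRel where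
  root : {M N : Tm Γ Δ A} → R M N → Comp R M N
  lamᶜ : {M N : Tm (A ∷ Γ) Δ B} → Comp R M N → Comp R (lam M) (lam N)
  appˡ : {M M' : Tm Γ Δ (A ⇒ B)} {N : Tm Γ Δ A} →
         Comp R M M' → Comp R (app M N) (app M' N)
  appʳ : {M : Tm Γ Δ (A ⇒ B)} {N N' : Tm Γ Δ A} →
         Comp R N N' → Comp R (app M N) (app M N')
  nmᶜ  : {α : Δ ∋ A} {M N : Tm Γ Δ A} → Comp R M N → Comp R (nm α M) (nm α N)
  muᶜ  : {M N : Tm Γ (A ∷ Δ) ⊥ₜ} → Comp R M N → Comp R (mu M) (mu N)

data AllowedRoot : TmRel where
  βr    : {M N : Tm Γ Δ A} → M →β N → AllowedRoot M N
  μr    : {M N : Tm Γ Δ A} → M →μ N → AllowedRoot M N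
  ρr    : {M N : Tm Γ Δ A} → M →ρ N → AllowedRoot M N
  νr    : {M N : Tm Γ Δ A} → M →ν N → AllowedRoot M N
  η-exp : {M N : Tm Γ Δ A} → N →η M → AllowedRoot M N
  θ-exp : {M N : Tm Γ Δ A} → N →θ M → AllowedRoot M N

infix 4 _⇝_ _⇝*_ _≈βημρθ_
_⇝_ : Tm Γ Δ A → Tm Γ Δ A → Set
M ⇝ N = Comp AllowedRoot M N

_⇝*_ : Tm Γ Δ A → Tm Γ Δ A → Set
M ⇝* N = Star _⇝_ M N

data EqRoot : TmRel where
  βe : {M N : Tm Γ Δ A} → M →β N → EqRoot M N
  ηe : {M N : Tm Γ Δ A} → M →η N → EqRoot M N
  μe : {M N : Tm Γ Δ A} → M →μ N → EqRoot M N
  ρe : {M N : Tm Γ Δ A} → M →ρ N → EqRoot M N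
  θe : {M N : Tm Γ Δ A} → M →θ N → EqRoot M N
  ⊥e : {M N : Tm Γ Δ A} → M =⊥ N → EqRoot M N

_≈βημρθ_ : Tm Γ Δ A → Tm Γ Δ A → Set
M ≈βημρθ N = EqClosure (Comp EqRoot) M N

data Simple : Tm Γ Δ A → Set where
  var : {x : Γ ∋ A} → Simple {Γ} {Δ} (var x)
  lam : {M : Tm (A ∷ Γ) Δ B} → Simple M → Simple (lam M)
  app : {M : Tm Γ Δ (A ⇒ B)} {N : Tm Γ Δ A} →
        Simple M → Simple N → Simple (app M N)
  mu  : {β : (A ∷ Δ) ∋ B} {M : Tm Γ (A ∷ Δ) B} →
        Simple M → Simple (mu (nm β M))

data CNF : Tm Γ Δ A → Set
data Spine : Tm Γ Δ A → Set

data CNF where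
  lamC : {M : Tm (A ∷ Γ) Δ B} → CNF M → CNF (lam M)
  muC  : {X Y : Atom} {β : (at X ∷ Δ) ∋ at Y} {S : Tm Γ (at X ∷ Δ) (at Y)} →
         Spine S → CNF {Γ} {Δ} {at X} (mu (nm β S))

data Spine where
  hd : {b : Γ ∋ A} → Spine {Γ} {Δ} (var b)
  ap : {S : Tm Γ Δ (A ⇒ B)} {N : Tm Γ Δ A} → Spine S → CNF N → Spine (app S N)

-- The normal forms used are η-long: λa⃗.μα[β](b)M⃗ with all μ-variables of
-- atomic type.  An application of normal forms normalises by β-steps and
-- hereditary substitution, by induction on the type; a variable normalises
-- by η-expansions ending in a θ-expansion.  A binder μα[β]M of type
-- A₁→…→Aₙ→X is taken by n ν-steps to λa⃗.μα.N, where N is M under renamings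
-- and structural substitutions [α](L)a/[α]L.  These are kept pending, so
-- that normalisation still recurses on M itself; since they only push
-- variables, [β]M becomes [γ](M)c⃗ under them, and as γ has atomic type a
-- single ρ-step brings μα[γ]R with R normal back to normal form.
module Submission where

open import Defs
open import Data.List using ([]; _∷_)
open import Data.List.Relation.Unary.All using (All; []; _∷_)
open import Data.Product using (Σ; Σ-syntax; _×_; _,_)
open import Function using (_∘_)
open import Relation.Binary.PropositionalEquality using (_≡_; refl; sym; cong; cong₂; subst; module ≡-Reasoning)
open import Relation.Binary.Construct.Closure.ReflexiveTransitive using (ε; _◅_; _◅◅_; gmap; return; _⋆)
open import Relation.Binary.Construct.Closure.Symmetric using (fwd; bwd)
import Relation.Binary.Construct.Closure.Equivalence as EqClosure

variable
  Γ'' Δ'' : Ctx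
  X Y : Atom

⇝*-lam : {M N : Tm (A ∷ Γ) Δ B} → M ⇝* N → lam M ⇝* lam N
⇝*-lam = gmap lam lamᶜ

⇝*-app : {M M' : Tm Γ Δ (A ⇒ B)} {N N' : Tm Γ Δ A} →
         M ⇝* M' → N ⇝* N' → app M N ⇝* app M' N'
⇝*-app {M' = M'} {N = N} u v = gmap (λ L → app L N) appˡ u ◅◅ gmap (app M') appʳ v

⇝*-nm : {α : Δ ∋ A} {M N : Tm Γ Δ A} → M ⇝* N → nm α M ⇝* nm α N
⇝*-nm {α = α} = gmap (nm α) nmᶜ

⇝*-mu : {M N : Tm Γ (A ∷ Δ) ⊥ₜ} → M ⇝* N → mu M ⇝* mu N
⇝*-mu = gmap mu muᶜ

infixr 5 _∷_
data Args (Γ Δ : Ctx) : Ty → Ty → Set where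
  []  : Args Γ Δ C C
  _∷_ : Tm Γ Δ A → Args Γ Δ B C → Args Γ Δ (A ⇒ B) C

infixl 6 _·_
_·_ : Tm Γ Δ B → Args Γ Δ B C → Tm Γ Δ C
M · []       = M
M · (N ∷ sp) = app M N · sp

infixl 5 _∷ʳ_
_∷ʳ_ : Args Γ Δ B (A ⇒ C) → Tm Γ Δ A → Args Γ Δ B C
[]       ∷ʳ E = E ∷ []
(N ∷ sp) ∷ʳ E = N ∷ (sp ∷ʳ E)

renₐ : Ren Γ Γ' → Ren Δ Δ' → Args Γ Δ B C → Args Γ' Δ' B C
renₐ r s []       = []
renₐ r s (N ∷ sp) = ren r s N ∷ renₐ r s sp

subₐ : Sub Γ Γ' Δ → Args Γ Δ B C → Args Γ' Δ B C
subₐ σ []       = []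
subₐ σ (N ∷ sp) = sub σ N ∷ subₐ σ sp

ren-· : (r : Ren Γ Γ') (s : Ren Δ Δ') (M : Tm Γ Δ B) (sp : Args Γ Δ B C) →
        ren r s (M · sp) ≡ ren r s M · renₐ r s sp
ren-· r s M []       = refl
ren-· r s M (N ∷ sp) = ren-· r s (app M N) sp

sub-· : (σ : Sub Γ Γ' Δ) (M : Tm Γ Δ B) (sp : Args Γ Δ B C) →
        sub σ (M · sp) ≡ sub σ M · subₐ σ sp
sub-· σ M []       = refl
sub-· σ M (N ∷ sp) = sub-· σ (app M N) sp

·-∷ʳ : (M : Tm Γ Δ B) (sp : Args Γ Δ B (A ⇒ C)) (E : Tm Γ Δ A) →
       M · (sp ∷ʳ E) ≡ app (M · sp) E
·-∷ʳ M []       E = refl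
·-∷ʳ M (N ∷ sp) E = ·-∷ʳ (app M N) sp E

infix 4 _⇝*ₐ_
data _⇝*ₐ_ {Γ Δ : Ctx} : Args Γ Δ B C → Args Γ Δ B C → Set where
  []  : _⇝*ₐ_ {B = C} {C} [] []
  _∷_ : {N N' : Tm Γ Δ A} {sp sp' : Args Γ Δ B C} →
        N ⇝* N' → sp ⇝*ₐ sp' → (N ∷ sp) ⇝*ₐ (N' ∷ sp')

⇝*ₐ-refl : (sp : Args Γ Δ B C) → sp ⇝*ₐ sp
⇝*ₐ-refl []       = []
⇝*ₐ-refl (N ∷ sp) = ε ∷ ⇝*ₐ-refl sp

⇝*-· : {M M' : Tm Γ Δ B} {sp sp' : Args Γ Δ B C} →
       M ⇝* M' → sp ⇝*ₐ sp' → M · sp ⇝* M' · sp'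
⇝*-· u []       = u
⇝*-· u (v ∷ vs) = ⇝*-· (⇝*-app u v) vs

-- As CNF, but with the arguments of the head in a cons-list, the shape
-- hereditary substitution consumes.
data NF : Tm Γ Δ A → Set
data NFArgs : Args Γ Δ B C → Set

data NF where
  lam : {M : Tm (A ∷ Γ) Δ B} → NF M → NF (lam M)
  mu  : {α : (at X ∷ Δ) ∋ at Y} {b : Γ ∋ B} {sp : Args Γ (at X ∷ Δ) B (at Y)} →
        NFArgs sp → NF {Γ} {Δ} {at X} (mu (nm α (var b · sp)))

data NFArgs where
  []  : NFArgs {Γ} {Δ} {C} {C} []
  _∷_ : {N : Tm Γ Δ A} {sp : Args Γ Δ B C} → NF N → NFArgs sp → NFArgs (N ∷ sp)

_∷ʳₙ_ : {sp : Args Γ Δ B (A ⇒ C)} {E : Tm Γ Δ A} →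
        NFArgs sp → NF E → NFArgs (sp ∷ʳ E)
[]        ∷ʳₙ e = e ∷ []
(n ∷ nsp) ∷ʳₙ e = n ∷ (nsp ∷ʳₙ e)

NF-ren : (r : Ren Γ Γ') (s : Ren Δ Δ') {M : Tm Γ Δ A} → NF M → NF (ren r s M)
NFArgs-ren : (r : Ren Γ Γ') (s : Ren Δ Δ') {sp : Args Γ Δ B C} →
             NFArgs sp → NFArgs (renₐ r s sp)
NF-ren r s (lam n) = lam (NF-ren (ext r) s n)
NF-ren r s (mu {α = α} {b = b} {sp = sp} nsp) =
  subst (λ T → NF (mu (nm (ext s α) T))) (sym (ren-· r (ext s) (var b) sp))
        (mu (NFArgs-ren r (ext s) nsp))
NFArgs-ren r s []        = []
NFArgs-ren r s (n ∷ nsp) = NF-ren r s n ∷ NFArgs-ren r s nsp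

NF⇒CNF : {M : Tm Γ Δ A} → NF M → CNF M
Spine-· : {S : Tm Γ Δ B} {sp : Args Γ Δ B C} → Spine S → NFArgs sp → Spine (S · sp)
NF⇒CNF (lam n)  = lamC (NF⇒CNF n)
NF⇒CNF (mu nsp)  = muC (Spine-· hd nsp)
Spine-· S []        = S
Spine-· S (n ∷ nsp) = Spine-· (ap S (NF⇒CNF n)) nsp

infix 4 _⇓ _⇓ₐ
_⇓ : Tm Γ Δ A → Set
_⇓ {Γ} {Δ} {A} M = Σ[ N ∈ Tm Γ Δ A ] NF N × M ⇝* N

_⇓ₐ : Args Γ Δ B C → Set
_⇓ₐ {Γ} {Δ} {B} {C} sp = Σ[ sp' ∈ Args Γ Δ B C ] NFArgs sp' × sp ⇝*ₐ sp'

NF⇒⇓ : {M : Tm Γ Δ A} → NF M → M ⇓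
NF⇒⇓ n = _ , n , ε

infixr 5 _◅◅⇓_
_◅◅⇓_ : {M M' : Tm Γ Δ A} → M ⇝* M' → M' ⇓ → M ⇓
u ◅◅⇓ (N , n , v) = N , n , u ◅◅ v

≡-⇓ : {M M' : Tm Γ Δ A} → M ≡ M' → M' ⇓ → M ⇓
≡-⇓ refl m = m

⇓-lam : {M : Tm (A ∷ Γ) Δ B} → M ⇓ → lam M ⇓
⇓-lam (N , n , u) = lam N , lam n , ⇝*-lam u

data IsAtom : Ty → Set where
  at : (X : Atom) → IsAtom (at X)

μ-ρ⇓ : (α : (at X ∷ Δ) ∋ C) → IsAtom C → {R : Tm Γ (at X ∷ Δ) C} → NF R → mu (nm α R) ⇓
μ-ρ⇓ α (at Y) (mu {α = δ} {b = c} {sp = sp} nsp) =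
  return (muᶜ (root (ρr ρ))) ◅◅⇓
  ≡-⇓ (cong (λ T → mu (nm (ren0 α δ) T)) (ren-· idR (ren0 α) (var c) sp))
      (NF⇒⇓ (mu (NFArgs-ren idR (ren0 α) nsp)))

η⇓ : {sp : Args Γ Δ B A} (b : Γ ∋ B) → NFArgs sp → var b · sp ⇓
η⇓ {A = at X} {sp = sp} b nsp =
  return (root (θ-exp θ)) ◅◅⇓
  ≡-⇓ (cong (λ T → mu (nm here T)) (ren-· idR there (var b) sp))
      (NF⇒⇓ (mu (NFArgs-ren idR there nsp)))
η⇓ {A = A₁ ⇒ A₂} {sp = sp} b nsp with η⇓ {sp = []} here []
... | E , nE , var⇝E =
  return (root (η-exp η)) ◅◅⇓
  ≡-⇓ (cong (λ T → lam (app T (var here))) (ren-· there idR (var b) sp))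
      (⇓-lam (⇝*-app ε var⇝E ◅◅⇓
              ≡-⇓ (sym (·-∷ʳ (var (there b)) (renₐ there idR sp) E))
                  (η⇓ (there b) (NFArgs-ren there idR nsp ∷ʳₙ nE))))

data VarOrNF (A : Ty) {Γ Δ : Ctx} : ∀ {C} → Tm Γ Δ C → Set where
  var : (x : Γ ∋ C) → VarOrNF A (var x)
  nf  : {N : Tm Γ Δ A} → NF N → VarOrNF A N

Hereditary : Ty → Sub Γ Γ' Δ → Set
Hereditary {Γ} A σ = ∀ {C} (x : Γ ∋ C) → VarOrNF A (σ x)

VarOrNF-ren : (r : Ren Γ Γ') (s : Ren Δ Δ') {N : Tm Γ Δ C} →
              VarOrNF A N → VarOrNF A (ren r s N)
VarOrNF-ren r s (var x) = var (r x)
VarOrNF-ren r s (nf n)  = nf (NF-ren r s n)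

Hereditary-exts : {σ : Sub Γ Γ' Δ} → Hereditary A σ → Hereditary A (exts {B = B} σ)
Hereditary-exts h here      = var here
Hereditary-exts h (there x) = VarOrNF-ren there idR (h x)

Hereditary-extsμ : {σ : Sub Γ Γ' Δ} → Hereditary A σ → Hereditary A (extsμ {B = B} σ)
Hereditary-extsμ h x = VarOrNF-ren idR there (h x)

Hereditary-sub0 : {N : Tm Γ Δ A} → NF N → Hereditary A (sub0 N)
Hereditary-sub0 n here      = nf n
Hereditary-sub0 n (there x) = var x

sub⇓  : {σ : Sub Γ Γ' Δ} → Hereditary A σ → {P : Tm Γ Δ C} → NF P → sub σ P ⇓
subₐ⇓ : {σ : Sub Γ Γ' Δ} → Hereditary A σ → {sp : Args Γ Δ B C} →
        NFArgs sp → subₐ σ sp ⇓ₐ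
head⇓ : (α : (at X ∷ Δ) ∋ at Y) {H : Tm Γ (at X ∷ Δ) B} → VarOrNF A H →
        {sp : Args Γ (at X ∷ Δ) B (at Y)} → NFArgs sp → mu (nm α (H · sp)) ⇓
·⇓    : {N : Tm Γ Δ A} → NF N → {sp : Args Γ Δ A C} → NFArgs sp → N · sp ⇓

sub⇓ h (lam n) = ⇓-lam (sub⇓ (Hereditary-exts h) n)
sub⇓ {σ = σ} h (mu {α = α} {b = b} {sp = sp} nsp) with subₐ⇓ (Hereditary-extsμ h) nsp
... | sp' , nsp' , sp⇝sp' =
  ≡-⇓ (cong (λ T → mu (nm α T)) (sub-· (extsμ σ) (var b) sp))
      (⇝*-mu (⇝*-nm (⇝*-· ε sp⇝sp')) ◅◅⇓ head⇓ α (Hereditary-extsμ h b) nsp')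

subₐ⇓ h []        = [] , [] , []
subₐ⇓ h (n ∷ nsp) with sub⇓ h n | subₐ⇓ h nsp
... | N , nN , u | sp , nsp' , us = N ∷ sp , nN ∷ nsp' , u ∷ us

head⇓ α (var x) nsp = NF⇒⇓ (mu nsp)
head⇓ α (nf n)  nsp with ·⇓ n nsp
... | R , nR , u = ⇝*-mu (⇝*-nm u) ◅◅⇓ μ-ρ⇓ α (at _) nR

·⇓ n [] = NF⇒⇓ n
·⇓ (lam p) {sp = M ∷ sp} (m ∷ nsp) with sub⇓ (Hereditary-sub0 m) p
... | R , nR , u = ⇝*-· (return (root (βr β)) ◅◅ u) (⇝*ₐ-refl sp) ◅◅⇓ ·⇓ nR nsp

data VarAct {Γ Δ : Ctx} : ∀ {C} → Act Γ Δ C → Set where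
  keep : {α : Δ ∋ C} → VarAct (keep α)
  push : {α : Δ ∋ B} {x : Γ ∋ A} → VarAct (push α (var x))

VarAct-actλ : {a : Act Γ Δ C} → VarAct a → VarAct (actλ {B = B} a)
VarAct-actλ keep = keep
VarAct-actλ push = push

VarAct-actμ : {a : Act Γ Δ C} → VarAct a → VarAct (actμ {B = B} a)
VarAct-actμ keep = keep
VarAct-actμ push = push

VarSSub : SSub Γ Δ Δ' → Set
VarSSub {Δ = Δ} σ = ∀ {C} (α : Δ ∋ C) → VarAct (σ α)

VarSSub-ssμ : {σ : SSub Γ Δ Δ'} → VarSSub σ → VarSSub (ssμ {B = B} σ)
VarSSub-ssμ v here      = keep
VarSSub-ssμ v (there α) = VarAct-actμ (v α)

σapp-var : VarSSub (σapp {Γ = A ∷ Γ} {Δ = Δ} {B = B} (var here))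
σapp-var here      = push
σapp-var (there α) = keep

data Op : Ctx → Ctx → Ctx → Ctx → Set where
  renᵒ  : Ren Γ Γ' → Ren Δ Δ' → Op Γ Δ Γ' Δ'
  ssubᵒ : (σ : SSub Γ Δ Δ') → VarSSub σ → Op Γ Δ Γ Δ'

applyᵒ : Op Γ Δ Γ' Δ' → Tm Γ Δ A → Tm Γ' Δ' A
applyᵒ (renᵒ r s)  = ren r s
applyᵒ (ssubᵒ σ _) = ssub σ

liftλᵒ : Op Γ Δ Γ' Δ' → Op (B ∷ Γ) Δ (B ∷ Γ') Δ'
liftλᵒ (renᵒ r s)  = renᵒ (ext r) s
liftλᵒ (ssubᵒ σ v) = ssubᵒ (ssλ σ) (VarAct-actλ ∘ v)

liftμᵒ : Op Γ Δ Γ' Δ' → Op Γ (B ∷ Δ) Γ' (B ∷ Δ')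
liftμᵒ (renᵒ r s)  = renᵒ r (ext s)
liftμᵒ (ssubᵒ σ v) = ssubᵒ (ssμ σ) (VarSSub-ssμ v)

infixl 5 _▷_
data Ops : Ctx → Ctx → Ctx → Ctx → Set where
  done : Ops Γ Δ Γ Δ
  _▷_  : Ops Γ Δ Γ' Δ' → Op Γ' Δ' Γ'' Δ'' → Ops Γ Δ Γ'' Δ''

apply : Ops Γ Δ Γ' Δ' → Tm Γ Δ A → Tm Γ' Δ' A
apply done       M = M
apply (ops ▷ op) M = applyᵒ op (apply ops M)

liftλ : Ops Γ Δ Γ' Δ' → Ops (B ∷ Γ) Δ (B ∷ Γ') Δ'
liftλ done       = done
liftλ (ops ▷ op) = liftλ ops ▷ liftλᵒ op

liftμ : Ops Γ Δ Γ' Δ' → Ops Γ (B ∷ Δ) Γ' (B ∷ Δ')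
liftμ done       = done
liftμ (ops ▷ op) = liftμ ops ▷ liftμᵒ op

λRen : Ops Γ Δ Γ' Δ' → Ren Γ Γ'
λRen done              x = x
λRen (ops ▷ renᵒ r s)  x = r (λRen ops x)
λRen (ops ▷ ssubᵒ σ v) x = λRen ops x

apply-var : (ops : Ops Γ Δ Γ' Δ') (x : Γ ∋ A) → apply ops (var {Δ = Δ} x) ≡ var (λRen ops x)
apply-var done              x = refl
apply-var (ops ▷ renᵒ r s)  x = cong (ren r s) (apply-var ops x)
apply-var (ops ▷ ssubᵒ σ v) x = cong (ssub σ) (apply-var ops x)

apply-lam : (ops : Ops Γ Δ Γ' Δ') (M : Tm (A ∷ Γ) Δ B) →
            apply ops (lam M) ≡ lam (apply (liftλ ops) M)
apply-lam done              M = refl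
apply-lam (ops ▷ renᵒ r s)  M = cong (ren r s) (apply-lam ops M)
apply-lam (ops ▷ ssubᵒ σ v) M = cong (ssub σ) (apply-lam ops M)

apply-app : (ops : Ops Γ Δ Γ' Δ') (M : Tm Γ Δ (A ⇒ B)) (N : Tm Γ Δ A) →
            apply ops (app M N) ≡ app (apply ops M) (apply ops N)
apply-app done              M N = refl
apply-app (ops ▷ renᵒ r s)  M N = cong (ren r s) (apply-app ops M N)
apply-app (ops ▷ ssubᵒ σ v) M N = cong (ssub σ) (apply-app ops M N)

apply-mu : (ops : Ops Γ Δ Γ' Δ') (M : Tm Γ (A ∷ Δ) ⊥ₜ) →
           apply ops (mu M) ≡ mu (apply (liftμ ops) M)
apply-mu done              M = refl
apply-mu (ops ▷ renᵒ r s)  M = cong (ren r s) (apply-mu ops M)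
apply-mu (ops ▷ ssubᵒ σ v) M = cong (ssub σ) (apply-mu ops M)

infixl 5 _▸_
data VarArgs (Γ : Ctx) : Ty → Ty → Set where
  []  : VarArgs Γ B B
  _▸_ : VarArgs Γ B (A ⇒ C) → Γ ∋ A → VarArgs Γ B C

infixl 6 _·ᵛ_
_·ᵛ_ : Tm Γ Δ B → VarArgs Γ B C → Tm Γ Δ C
M ·ᵛ []       = M
M ·ᵛ (xs ▸ x) = app (M ·ᵛ xs) (var x)

renᵛ : Ren Γ Γ' → VarArgs Γ B C → VarArgs Γ' B C
renᵛ r []       = []
renᵛ r (xs ▸ x) = renᵛ r xs ▸ r x

ren-·ᵛ : (r : Ren Γ Γ') (s : Ren Δ Δ') (M : Tm Γ Δ B) (xs : VarArgs Γ B C) →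
         ren r s (M ·ᵛ xs) ≡ ren r s M ·ᵛ renᵛ r xs
ren-·ᵛ r s M []       = refl
ren-·ᵛ r s M (xs ▸ x) = cong (λ T → app T (var (r x))) (ren-·ᵛ r s M xs)

ssub-·ᵛ : (σ : SSub Γ Δ Δ') (M : Tm Γ Δ B) (xs : VarArgs Γ B C) →
          ssub σ (M ·ᵛ xs) ≡ ssub σ M ·ᵛ xs
ssub-·ᵛ σ M []       = refl
ssub-·ᵛ σ M (xs ▸ x) = cong (λ T → app T (var x)) (ssub-·ᵛ σ M xs)

⇝*-·ᵛ : {M M' : Tm Γ Δ B} (xs : VarArgs Γ B C) → M ⇝* M' → M ·ᵛ xs ⇝* M' ·ᵛ xs
⇝*-·ᵛ []       u = u
⇝*-·ᵛ (xs ▸ x) u = ⇝*-app (⇝*-·ᵛ xs u) ε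

·ᵛ⇓ : {R : Tm Γ Δ B} → NF R → (xs : VarArgs Γ B C) → R ·ᵛ xs ⇓
·ᵛ⇓ n []       = NF⇒⇓ n
·ᵛ⇓ n (xs ▸ x) with ·ᵛ⇓ n xs | η⇓ {sp = []} x []
... | R , nR , u | E , nE , v = ⇝*-app u v ◅◅⇓ ·⇓ nR (nE ∷ [])

record Renamed (ops : Ops Γ Δ Γ' Δ') (α : Δ ∋ B) : Set where
  constructor renamed
  field
    {target} : Ty
    γ        : Δ' ∋ target
    pushed   : VarArgs Γ' B target
    apply-nm : (M : Tm Γ Δ B) → apply ops (nm α M) ≡ nm γ (apply ops M ·ᵛ pushed)

applyAct-·ᵛ : {a : Act Γ Δ C} → VarAct a → (xs : VarArgs Γ B C) →
  Σ[ C' ∈ Ty ] Σ[ γ ∈ Δ ∋ C' ] Σ[ xs' ∈ VarArgs Γ B C' ]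
    ((M : Tm Γ Δ B) → applyAct a (M ·ᵛ xs) ≡ nm γ (M ·ᵛ xs'))
applyAct-·ᵛ (keep {α = α}) xs = _ , α , xs , λ M → refl
applyAct-·ᵛ (push {α = α} {x = x}) xs = _ , α , xs ▸ x , λ M → refl

renamed-nm : (ops : Ops Γ Δ Γ' Δ') (α : Δ ∋ B) → Renamed ops α
renamed-nm done α = renamed α [] λ M → refl
renamed-nm (ops ▷ renᵒ r s) α with renamed-nm ops α
... | renamed γ xs eq = renamed (s γ) (renᵛ r xs) λ M →
  begin
    ren r s (apply ops (nm α M))            ≡⟨ cong (ren r s) (eq M) ⟩
    nm (s γ) (ren r s (apply ops M ·ᵛ xs))  ≡⟨ cong (nm (s γ)) (ren-·ᵛ r s (apply ops M) xs) ⟩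
    nm (s γ) (apply (ops ▷ renᵒ r s) M ·ᵛ renᵛ r xs)
  ∎
  where open ≡-Reasoning
renamed-nm (ops ▷ ssubᵒ σ v) α with renamed-nm ops α
... | renamed γ xs eq with applyAct-·ᵛ (v γ) xs
... | _ , γ' , xs' , eq' = renamed γ' xs' λ M →
  begin
    ssub σ (apply ops (nm α M))                    ≡⟨ cong (ssub σ) (eq M) ⟩
    applyAct (σ γ) (ssub σ (apply ops M ·ᵛ xs))    ≡⟨ cong (applyAct (σ γ)) (ssub-·ᵛ σ (apply ops M) xs) ⟩
    applyAct (σ γ) (ssub σ (apply ops M) ·ᵛ xs)    ≡⟨ eq' (ssub σ (apply ops M)) ⟩
    nm γ' (apply (ops ▷ ssubᵒ σ v) M ·ᵛ xs')
  ∎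
  where open ≡-Reasoning

lookupAtom : All IsAtom Δ → Δ ∋ C → IsAtom C
lookupAtom (a ∷ _)  here      = a
lookupAtom (_ ∷ as) (there α) = lookupAtom as α

normalise : All IsAtom Δ' → (ops : Ops Γ Δ Γ' Δ') {M : Tm Γ Δ A} → Simple M → apply ops M ⇓
-- ops sends the μ-variable of type A to one of type A', the part of A left
-- after the ν-steps taken so far.
normalise-μ : ∀ A' → All IsAtom Δ' → (ops : Ops Γ (A ∷ Δ) Γ' (A' ∷ Δ')) (α : (A ∷ Δ) ∋ B)
              {M : Tm Γ (A ∷ Δ) B} → Simple M → mu (apply ops (nm α M)) ⇓

normalise ats ops (var {x = x}) = ≡-⇓ (apply-var ops x) (η⇓ (λRen ops x) [])
normalise ats ops (lam {M = M} s) =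
  ≡-⇓ (apply-lam ops M) (⇓-lam (normalise ats (liftλ ops) s))
normalise ats ops (app {M = M} {N = N} s t) with normalise ats ops s | normalise ats ops t
... | M' , nM , u | N' , nN , v =
  ≡-⇓ (apply-app ops M N) (⇝*-app u v ◅◅⇓ ·⇓ nM (nN ∷ []))
normalise ats ops (mu {β = α} {M = M} s) =
  ≡-⇓ (apply-mu ops (nm α M)) (normalise-μ _ ats (liftμ ops) α s)

normalise-μ (A₁ ⇒ A₂) ats ops α s =
  return (root (νr ν)) ◅◅⇓
  ⇓-lam (normalise-μ A₂ ats (ops ▷ renᵒ there idR ▷ ssubᵒ (σapp (var here)) σapp-var) α s)
normalise-μ (at X) ats ops α {M} s with renamed-nm ops α | normalise (at X ∷ ats) ops s
... | renamed γ xs eq | M' , nM , u with ·ᵛ⇓ nM xs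
... | R , nR , v =
  ≡-⇓ (cong mu (eq M))
      (⇝*-mu (⇝*-nm (⇝*-·ᵛ xs u ◅◅ v)) ◅◅⇓ μ-ρ⇓ γ (lookupAtom (at X ∷ ats) γ) nR)

ext-cong : {r r' : Ren Γ Γ'} → (∀ {C} (x : Γ ∋ C) → r x ≡ r' x) →
           (x : (B ∷ Γ) ∋ C) → ext r x ≡ ext r' x
ext-cong eq here      = refl
ext-cong eq (there x) = cong there (eq x)

ren-cong : {r r' : Ren Γ Γ'} {s s' : Ren Δ Δ'} →
           (∀ {C} (x : Γ ∋ C) → r x ≡ r' x) → (∀ {C} (α : Δ ∋ C) → s α ≡ s' α) →
           (M : Tm Γ Δ A) → ren r s M ≡ ren r' s' M
ren-cong eqr eqs (var x)   = cong var (eqr x)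
ren-cong eqr eqs (lam M)   = cong lam (ren-cong (ext-cong eqr) eqs M)
ren-cong eqr eqs (app M N) = cong₂ app (ren-cong eqr eqs M) (ren-cong eqr eqs N)
ren-cong eqr eqs (nm α M)  = cong₂ nm (eqs α) (ren-cong eqr eqs M)
ren-cong eqr eqs (mu M)    = cong mu (ren-cong eqr (ext-cong eqs) M)

ext-idR : (x : (B ∷ Δ) ∋ C) → ext idR x ≡ x
ext-idR here      = refl
ext-idR (there x) = refl

-- A ν-step is an η-expansion followed by a μ-step.
ν-sound : (M : Tm Γ ((A ⇒ B) ∷ Δ) ⊥ₜ) →
          mu M ≈βημρθ lam (mu (ssub (σapp (var here)) (wkλ M)))
ν-sound M =
  subst (λ T → mu M ≈βημρθ lam (mu (ssub (σapp (var here)) T)))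
        (ren-cong (λ x → refl) ext-idR M)
        (bwd (root (ηe η)) ◅ fwd (lamᶜ (root (μe μ))) ◅ ε)

allowed⇒≈ : {M N : Tm Γ Δ A} → AllowedRoot M N → M ≈βημρθ N
allowed⇒≈ (βr s)           = EqClosure.return (root (βe s))
allowed⇒≈ (μr s)           = EqClosure.return (root (μe s))
allowed⇒≈ (ρr s)           = EqClosure.return (root (ρe s))
allowed⇒≈ (νr (ν {M = M})) = ν-sound M
allowed⇒≈ (η-exp s)        = bwd (root (ηe s)) ◅ ε
allowed⇒≈ (θ-exp s)        = bwd (root (θe s)) ◅ ε

⇝⇒≈ : {M N : Tm Γ Δ A} → M ⇝ N → M ≈βημρθ N
⇝⇒≈ (root s)         = allowed⇒≈ s
⇝⇒≈ (lamᶜ s)         = EqClosure.gmap lam lamᶜ (⇝⇒≈ s)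
⇝⇒≈ (appˡ {N = N} s) = EqClosure.gmap (λ L → app L N) appˡ (⇝⇒≈ s)
⇝⇒≈ (appʳ {M = M} s) = EqClosure.gmap (app M) appʳ (⇝⇒≈ s)
⇝⇒≈ (nmᶜ {α = α} s)  = EqClosure.gmap (nm α) nmᶜ (⇝⇒≈ s)
⇝⇒≈ (muᶜ s)          = EqClosure.gmap mu muᶜ (⇝⇒≈ s)

⇝*⇒≈ : {M N : Tm Γ Δ A} → M ⇝* N → M ≈βημρθ N
⇝*⇒≈ = ⇝⇒≈ ⋆

mainTheorem5 : ∀ {Γ A} (M : Tm Γ [] A) → Simple M →
    Σ (Tm Γ [] A) (λ N → CNF N × (M ≈βημρθ N) × (M ⇝* N))
mainTheorem5 M s =
  let N , n , M⇝*N = normalise [] done s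
  in  N , NF⇒CNF n , ⇝*⇒≈ M⇝*N , M⇝*N
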